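{- Let $\mathfrak X$ be an $\ell$-variate $P$-polynomial association scheme on $\mathcal D\subset\mathbb N^\ell$ with respect to a monomial order $\le$, with adjacency matrices labeled $\{A_\alpha\}_{\alpha\in\mathcal D}$, and let $\mathcal G$ be the set of polynomials $w_{\alpha+\epsilon_i}$ defined below. Then for every $\alpha\in\mathbb N^\ell\setminus\mathcal D$ there exist $\beta_0\in\mathrm{MD}(\mathcal G)=\{\mathrm{MD}(g)\mid g\in\mathcal G\}$ and $\gamma_0\in\mathbb N^\ell$ such that $\alpha=\beta_0+\gamma_0$.
   Context: Commutative association scheme: finite set $X$ with a partition of $X\times X$ into relations whose $0/1$ adjacency matrices satisfy $\sum A_i=J$, some $A_i=I$, closure under transpose, $A_iA_j=\sum_kp^k_{ij}A_k$, and $A_iA_j=A_jA_i$. Notation: $\epsilon_i$ the $i$-th unit vector; $\mathbf x^{(m_1,\dots,m_\ell)}=x_1^{m_1}\cdots x_\ell^{m_\ell}$; $\mathbf A^{(m_1,\dots,m_\ell)}=A_{\epsilon_1}^{m_1}\cdots A_{\epsilon_\ell}^{m_\ell}$. A monomial order is a total well-order $\le$ on $\mathbb N^\ell$ with $\alpha\le\beta\Rightarrow\alpha+\gamma\le\beta+\gamma$; $\mathrm{MD}(f)$, the multidegree of a nonzero polynomial $f$, is its $\le$-largest exponent with nonzero coefficient. Definition: for $\mathcal D\subset\mathbb N^\ell$ containing $\epsilon_1,\dots,\epsilon_\ell$, a commutative association scheme is $\ell$-variate $P$-polynomial on $\mathcal D$ w.r.t. $\le$ if (i) whenever $(n_k)\in\mathcal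 D$ and $0\le m_k\le n_k$ for all $k$, $(m_k)\in\mathcal D$; (ii) its adjacency matrices are labeled bijectively $\{A_\alpha\}_{\alpha\in\mathcal D}$ with $A_\alpha=v_\alpha(A_{\epsilon_1},\dots,A_{\epsilon_\ell})$ for a polynomial $v_\alpha$ of multidegree $\alpha$ all of whose monomials $\mathbf x^\beta$ have $\beta\in\mathcal D$; (iii) for each $i$ and $\alpha\in\mathcal D$, $A_{\epsilon_i}\mathbf A^\alpha$ is a linear combination of $\{\mathbf A^\beta\mid\beta\in\mathcal D,\beta\le\alpha+\epsilon_i\}$. Definition of $\mathcal G$: for $\alpha\in\mathcal D$ and $i$ with $\alpha+\epsilon_i\notin\mathcal D$, condition (iii) gives $\mathbf A^{\alpha+\epsilon_i}=\sum_{\beta\in\mathcal D,\beta<\alpha+\epsilon_i}c_\beta\mathbf A^\beta$, the coefficients being unique since $\{\mathbf A^\beta\}_{\beta\in\mathcal D}$ is linearly independent; set $w_{\alpha+\epsilon_i}(\mathbf x)=\mathbf x^{\alpha+\epsilon_i}-\sum_{\beta\in\mathcal D,\beta<\alpha+\epsilon_i}c_\beta\mathbf x^\beta$ (which depends only on $\alpha+\epsilon_i$), and $\mathcal G=\{w_{\alpha+\epsilon_i}\mid\alpha\in\mathcal D,\ 1\le i\le\ell,\ \alpha+\epsilon_i\notin\mathcal D\}$. -}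

module Defs where

open import Data.Nat as ℕ using (ℕ)
open import Data.Fin as Fin using (Fin)
open import Data.Fin.Properties using () renaming (_≟_ to _≟ᶠ_)
open import Data.Vec using (Vec; tabulate; zipWith; lookup)
open import Data.Vec.Properties using (≡-dec)
open import Data.List using (List; []; _∷_; foldr; map)
open import Data.List.Membership.Propositional using (_∈_)
open import Data.List.Relation.Unary.Unique.Propositional using (Unique)
open import Data.Rational as ℚ using (ℚ; 0ℚ; 1ℚ)
open import Data.Product using (Σ; ∃; _×_; _,_)
open import Data.Sum using (_⊎_)
open import Data.Bool using (if_then_else_)
open import Relation.Nullary using (¬_; yes; no)
open import Relation.Nullary.Decidable using (⌊_⌋)
open import Relation.Binary.PropositionalEquality using (_≡_; _≢_)
open import Relation.Binary.Structures using (IsTotalOrder)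
open import Induction.WellFounded using (WellFounded)

Exp : ℕ → Set
Exp ℓ = Vec ℕ ℓ

_⊕_ : ∀ {ℓ} → Exp ℓ → Exp ℓ → Exp ℓ
_⊕_ = zipWith ℕ._+_

ε : ∀ {ℓ} → Fin ℓ → Exp ℓ
ε i = tabulate (λ j → if ⌊ i ≟ᶠ j ⌋ then 1 else 0)

_≤ᶜ_ : ∀ {ℓ} → Exp ℓ → Exp ℓ → Set
m ≤ᶜ n = ∀ k → lookup m k ℕ.≤ lookup n k

_≟ᵉ_ : ∀ {ℓ} (a b : Exp ℓ) → Relation.Nullary.Dec (a ≡ b)
_≟ᵉ_ = ≡-dec ℕ._≟_

record MonomialOrder (ℓ : ℕ) : Set₁ where
  field
    _≤ₘ_         : Exp ℓ → Exp ℓ → Set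
    isTotalOrder : IsTotalOrder _≡_ _≤ₘ_
    wellFounded  : WellFounded (λ a b → a ≤ₘ b × a ≢ b)
    compatible   : ∀ a b c → a ≤ₘ b → (a ⊕ c) ≤ₘ (b ⊕ c)

  _<ₘ_ : Exp ℓ → Exp ℓ → Set
  a <ₘ b = a ≤ₘ b × a ≢ b

Mat : ℕ → Set
Mat n = Fin n → Fin n → ℚ

sumℚ : List ℚ → ℚ
sumℚ = foldr ℚ._+_ 0ℚ

_≈ᴹ_ : ∀ {n} → Mat n → Mat n → Set
A ≈ᴹ B = ∀ x y → A x y ≡ B x y

_*ᴹ_ : ∀ {n} → Mat n → Mat n → Mat n
_*ᴹ_ {n} A B x y = sumℚ (map (λ z → A x z ℚ.* B z y) (Data.List.allFin n))

Iᴹ : ∀ {n} → Mat n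
Iᴹ x y = if ⌊ x ≟ᶠ y ⌋ then 1ℚ else 0ℚ

_^ᴹ_ : ∀ {n} → Mat n → ℕ → Mat n
A ^ᴹ ℕ.zero  = Iᴹ
A ^ᴹ ℕ.suc k = A *ᴹ (A ^ᴹ k)

_·ᴹ_ : ∀ {n} → ℚ → Mat n → Mat n
(c ·ᴹ A) x y = c ℚ.* A x y

_+ᴹ_ : ∀ {n} → Mat n → Mat n → Mat n
(A +ᴹ B) x y = A x y ℚ.+ B x y

0ᴹ : ∀ {n} → Mat n
0ᴹ _ _ = 0ℚ

Σᴹ : ∀ {n} {I : Set} → List I → (I → Mat n) → Mat n
Σᴹ L f = foldr (λ β M → f β +ᴹ M) 0ᴹ L

-- Commutative association scheme on X = Fin n whose relations are
-- labelled bijectively by the (duplicate-free) list Ds of exponents,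
-- relation α having adjacency matrix A α.

record IsCommAssocScheme {ℓ} (n : ℕ) (Ds : List (Exp ℓ)) (A : Exp ℓ → Mat n) : Set where
  field
    labelsDistinct : Unique Ds
    zeroOne        : ∀ α → α ∈ Ds → ∀ x y → A α x y ≡ 0ℚ ⊎ A α x y ≡ 1ℚ
    nonempty       : ∀ α → α ∈ Ds → ∃ λ x → ∃ λ y → A α x y ≡ 1ℚ
    sumJ           : ∀ x y → sumℚ (map (λ α → A α x y) Ds) ≡ 1ℚ
    hasIdentity    : ∃ λ α → α ∈ Ds × A α ≈ᴹ Iᴹ
    transposeClosed : ∀ α → α ∈ Ds → ∃ λ β → β ∈ Ds × (∀ x y → A β x y ≡ A α y x)
    productClosed  : ∀ α β → α ∈ Ds → β ∈ Ds →
                     ∃ λ (p : Exp ℓ → ℚ) → (A α *ᴹ A β) ≈ᴹ Σᴹ Ds (λ γ → p γ ·ᴹ A γ)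
    commutative    : ∀ α β → α ∈ Ds → β ∈ Ds → (A α *ᴹ A β) ≈ᴹ (A β *ᴹ A α)

-- Polynomials in ℓ variables with rational coefficients, as a finite
-- formal sum of terms c·x^β.

Poly : ℕ → Set
Poly ℓ = List (ℚ × Exp ℓ)

coeff : ∀ {ℓ} → Poly ℓ → Exp ℓ → ℚ
coeff [] γ = 0ℚ
coeff ((c , β) ∷ p) γ = (if ⌊ β ≟ᵉ γ ⌋ then c else 0ℚ) ℚ.+ coeff p γ

IsMD : ∀ {ℓ} → MonomialOrder ℓ → Poly ℓ → Exp ℓ → Set
IsMD ord f β = coeff f β ≢ 0ℚ × (∀ γ → coeff f γ ≢ 0ℚ → γ ≤ₘ β)
  where open MonomialOrder ord

Apow : ∀ {ℓ n} → (Exp ℓ → Mat n) → Exp ℓ → Mat n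
Apow {ℓ} A m = foldr (λ k M → (A (ε k) ^ᴹ lookup m k) *ᴹ M) Iᴹ (Data.List.allFin ℓ)

evalPoly : ∀ {ℓ n} → (Exp ℓ → Mat n) → Poly ℓ → Mat n
evalPoly A p = foldr (λ t M → (Data.Product.proj₁ t ·ᴹ Apow A (Data.Product.proj₂ t)) +ᴹ M) 0ᴹ p

record IsPPolynomial {ℓ n} (ord : MonomialOrder ℓ) (Ds : List (Exp ℓ)) (A : Exp ℓ → Mat n) : Set where
  open MonomialOrder ord
  field
    scheme      : IsCommAssocScheme n Ds A
    unitsInD    : ∀ i → ε i ∈ Ds
    downClosed  : ∀ α β → α ∈ Ds → β ≤ᶜ α → β ∈ Ds
    polynomial  : ∀ α → α ∈ Ds →
                  ∃ λ (v : Poly ℓ) → IsMD ord v α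
                    × (∀ β → coeff v β ≢ 0ℚ → β ∈ Ds)
                    × evalPoly A v ≈ᴹ A α
    -- (iii)
    recurrence  : ∀ i α → α ∈ Ds →
                  ∃ λ (c : Exp ℓ → ℚ) → (∀ β → c β ≢ 0ℚ → β ≤ₘ (α ⊕ ε i))
                    × (A (ε i) *ᴹ Apow A α) ≈ᴹ Σᴹ Ds (λ β → c β ·ᴹ Apow A β)

-- The set 𝒢 : g ∈ 𝒢 iff g = w_{α+ε_i} for some α ∈ D, i with α+ε_i ∉ D,
-- where A^{α+ε_i} = Σ_{β∈D, β<α+ε_i} c_β A^β (coefficients unique) and
-- w_{α+ε_i} = x^{α+ε_i} - Σ c_β x^β  (compared coefficientwise).

InG : ∀ {ℓ n} → MonomialOrder ℓ → List (Exp ℓ) → (Exp ℓ → Mat n) → Poly ℓ → Set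
InG {ℓ} ord Ds A g =
  ∃ λ (α : Exp ℓ) → ∃ λ (i : Fin ℓ) → α ∈ Ds × ¬ ((α ⊕ ε i) ∈ Ds) ×
    ∃ λ (c : Exp ℓ → ℚ) →
        (∀ β → c β ≢ 0ℚ → β ∈ Ds × β <ₘ (α ⊕ ε i))
      × (Apow A (α ⊕ ε i) ≈ᴹ Σᴹ Ds (λ β → c β ·ᴹ Apow A β))
      × (∀ γ → coeff g γ ≡ (if ⌊ γ ≟ᵉ (α ⊕ ε i) ⌋ then 1ℚ else 0ℚ) ℚ.- c γ)
  where open MonomialOrder ord

InMDG : ∀ {ℓ n} → MonomialOrder ℓ → List (Exp ℓ) → (Exp ℓ → Mat n) → Exp ℓ → Set
InMDG {ℓ} ord Ds A β = ∃ λ (g : Poly ℓ) → InG ord Ds A g × IsMD ord g β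

{-# OPTIONS --safe #-}

-- Starting from α ∉ D, remove one unit from the first nonzero coordinate at a time. Since 0 ∈ D (D is
-- down-closed), this descent reaches D, and its last step crosses the boundary: α = (a + ε_i) + γ with
-- a ∈ D, δ = a + ε_i ∉ D and a vanishing at all coordinates before i. For such a, the factors of A^a
-- before the i-th are identities, so A^δ = A_{ε_i} A^a without any commutativity. Condition (iii) at
-- (a, i) then writes A^δ through A^β with β ∈ D and β ≤ δ, hence β < δ as δ ∉ D; the resulting
-- w_δ ∈ 𝒢 has leading term x^δ, so δ ∈ MD(𝒢).

module Submission where

open import Defs
open import Data.Nat using (ℕ; zero; suc; _+_; _≤_; s≤s; z≤n)
import Data.Nat.Properties as ℕ
open import Data.Fin as Fin using (Fin; zero; suc)
open import Data.Fin.Properties using (suc-injective; <⇒≢) renaming (_≟_ to _≟ᶠ_)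
open import Data.List using (List; []; _∷_; foldr; map; tabulate; allFin)
import Data.List.Properties as List
open import Data.List.Membership.Propositional using (_∈_)
open import Data.List.Relation.Unary.Any using (here; there)
import Data.List.Relation.Unary.All as All
open import Data.List.Relation.Unary.AllPairs using (_∷_)
open import Data.List.Relation.Unary.Unique.Propositional using (Unique)
open import Data.Vec as Vec using (_∷_; []; lookup)
import Data.Vec.Properties as Vec
import Data.Vec.Functional as Vector
open import Data.Rational as ℚ using (ℚ; 0ℚ; 1ℚ)
import Data.Rational.Properties as ℚ
open import Data.Bool using (if_then_else_)
open import Data.Product using (∃; _×_; _,_; proj₁; proj₂)
open import Data.Empty using (⊥-elim)
open import Function using (_∘_)
open import Level using (0ℓ)
open import Algebra.Bundles using (Ring)
open import Relation.Nullary using (¬_; yes; no; contradiction)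
open import Relation.Nullary.Decidable using (⌊_⌋; map′; ⌊⌋-map′; isYes≗does; does-≡; dec-true; dec-false)
open import Relation.Unary using (Decidable)
open import Relation.Binary.Bundles using (Setoid)
open import Relation.Binary.Structures using (IsTotalOrder)
open import Relation.Binary.PropositionalEquality
import Relation.Binary.Reasoning.Setoid as SetoidReasoning
open import Algebra.Properties.Semiring.Sum (Ring.semiring ℚ.+-*-ring)
  using (sum; sum-cong-≗; sum-replicate-zero; ∑-comm; *-distribˡ-sum; *-distribʳ-sum)

sumℚ-tabulate : ∀ {n} (f : Fin n → ℚ) → sumℚ (tabulate f) ≡ sum f
sumℚ-tabulate {zero}  f = refl
sumℚ-tabulate {suc n} f = cong (f zero ℚ.+_) (sumℚ-tabulate (f ∘ suc))

*ᴹ-entry : ∀ {n} (A B : Mat n) x y → (A *ᴹ B) x y ≡ sum (λ z → A x z ℚ.* B z y)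
*ᴹ-entry A B x y = trans (cong sumℚ (List.map-tabulate (λ z → z) f)) (sumℚ-tabulate f)
  where
  f : Fin _ → ℚ
  f z = A x z ℚ.* B z y

≈ᴹ-setoid : ℕ → Setoid 0ℓ 0ℓ
≈ᴹ-setoid n = record
  { Carrier       = Mat n
  ; _≈_           = _≈ᴹ_
  ; isEquivalence = record
    { refl  = λ _ _ → refl
    ; sym   = λ p x y → sym (p x y)
    ; trans = λ p q x y → trans (p x y) (q x y)
    }
  }

module _ {n : ℕ} where

  open Setoid (≈ᴹ-setoid n) public using () renaming (refl to ≈ᴹ-refl; sym to ≈ᴹ-sym; trans to ≈ᴹ-trans)

  ≡⇒≈ᴹ : {A B : Mat n} → A ≡ B → A ≈ᴹ B
  ≡⇒≈ᴹ refl _ _ = refl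

  *ᴹ-cong : {A A′ B B′ : Mat n} → A ≈ᴹ A′ → B ≈ᴹ B′ → (A *ᴹ B) ≈ᴹ (A′ *ᴹ B′)
  *ᴹ-cong A≈A′ B≈B′ x y =
    cong sumℚ (List.map-cong (λ z → cong₂ ℚ._*_ (A≈A′ x z) (B≈B′ z y)) (allFin n))

  *ᴹ-congˡ : (A : Mat n) {B B′ : Mat n} → B ≈ᴹ B′ → (A *ᴹ B) ≈ᴹ (A *ᴹ B′)
  *ᴹ-congˡ A = *ᴹ-cong {A} ≈ᴹ-refl

  *ᴹ-congʳ : {A A′ : Mat n} (B : Mat n) → A ≈ᴹ A′ → (A *ᴹ B) ≈ᴹ (A′ *ᴹ B)
  *ᴹ-congʳ B A≈A′ = *ᴹ-cong A≈A′ (≈ᴹ-refl {B})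

  *ᴹ-assoc : (A B C : Mat n) → ((A *ᴹ B) *ᴹ C) ≈ᴹ (A *ᴹ (B *ᴹ C))
  *ᴹ-assoc A B C x y = begin
    ((A *ᴹ B) *ᴹ C) x y
      ≡⟨ *ᴹ-entry (A *ᴹ B) C x y ⟩
    sum (λ z → (A *ᴹ B) x z ℚ.* C z y)
      ≡⟨ sum-cong-≗ (λ z → cong (ℚ._* C z y) (*ᴹ-entry A B x z)) ⟩
    sum (λ z → sum (λ w → A x w ℚ.* B w z) ℚ.* C z y)
      ≡⟨ sum-cong-≗ (λ z → *-distribʳ-sum (C z y) (λ w → A x w ℚ.* B w z)) ⟩
    sum (λ z → sum (λ w → (A x w ℚ.* B w z) ℚ.* C z y))
      ≡⟨ ∑-comm (λ z w → (A x w ℚ.* B w z) ℚ.* C z y) ⟩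
    sum (λ w → sum (λ z → (A x w ℚ.* B w z) ℚ.* C z y))
      ≡⟨ sum-cong-≗ (λ w → sum-cong-≗ (λ z → ℚ.*-assoc (A x w) (B w z) (C z y))) ⟩
    sum (λ w → sum (λ z → A x w ℚ.* (B w z ℚ.* C z y)))
      ≡⟨ sum-cong-≗ (λ w → sym (*-distribˡ-sum (A x w) (λ z → B w z ℚ.* C z y))) ⟩
    sum (λ w → A x w ℚ.* sum (λ z → B w z ℚ.* C z y))
      ≡⟨ sum-cong-≗ (λ w → cong (A x w ℚ.*_) (sym (*ᴹ-entry B C w y))) ⟩
    sum (λ w → A x w ℚ.* (B *ᴹ C) w y)
      ≡⟨ sym (*ᴹ-entry A (B *ᴹ C) x y) ⟩
    (A *ᴹ (B *ᴹ C)) x y ∎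
    where open ≡-Reasoning

sum-indicator : ∀ {n} (x : Fin n) (f : Fin n → ℚ) →
  sum (λ z → (if ⌊ x ≟ᶠ z ⌋ then 1ℚ else 0ℚ) ℚ.* f z) ≡ f x
sum-indicator {suc n} zero f =
  trans (cong₂ ℚ._+_ (ℚ.*-identityˡ (f zero))
                     (trans (sum-cong-≗ (λ z → ℚ.*-zeroˡ (f (suc z)))) (sum-replicate-zero n)))
        (ℚ.+-identityʳ (f zero))
sum-indicator {suc n} (suc x) f =
  trans (cong₂ ℚ._+_ (ℚ.*-zeroˡ (f zero))
                     (trans (sum-cong-≗ (λ z → cong (λ b → (if b then 1ℚ else 0ℚ) ℚ.* f (suc z))
                                                     (⌊⌋-map′ _ _ (x ≟ᶠ z))))
                            (sum-indicator x (f ∘ suc))))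
        (ℚ.+-identityˡ (f (suc x)))

*ᴹ-identityˡ : ∀ {n} (M : Mat n) → (Iᴹ *ᴹ M) ≈ᴹ M
*ᴹ-identityˡ M x y = trans (*ᴹ-entry Iᴹ M x y) (sum-indicator x (λ z → M z y))

Σᴹ-cong : ∀ {n} {I : Set} (L : List I) {f g : I → Mat n} →
  (∀ β → β ∈ L → f β ≈ᴹ g β) → Σᴹ L f ≈ᴹ Σᴹ L g
Σᴹ-cong []      f≈g x y = refl
Σᴹ-cong (β ∷ L) f≈g x y =
  cong₂ ℚ._+_ (f≈g β (here refl) x y) (Σᴹ-cong L (λ γ γ∈L → f≈g γ (there γ∈L)) x y)

∏ᴹ : ∀ {n k} → (Fin k → Mat n) → Mat n
∏ᴹ = Vector.foldr _*ᴹ_ Iᴹ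

∏ᴹ-cong : ∀ {n k} {F G : Fin k → Mat n} → (∀ j → F j ≈ᴹ G j) → ∏ᴹ F ≈ᴹ ∏ᴹ G
∏ᴹ-cong {k = zero}  F≈G = ≈ᴹ-refl
∏ᴹ-cong {k = suc k} F≈G = *ᴹ-cong (F≈G zero) (∏ᴹ-cong (F≈G ∘ suc))

∏ᴹ-pull : ∀ {n k} (B : Mat n) (F G : Fin k → Mat n) (j : Fin k) →
  (∀ j′ → j′ Fin.< j → F j′ ≈ᴹ Iᴹ × G j′ ≈ᴹ Iᴹ) →
  G j ≈ᴹ (B *ᴹ F j) →
  (∀ j′ → j′ ≢ j → G j′ ≈ᴹ F j′) →
  ∏ᴹ G ≈ᴹ (B *ᴹ ∏ᴹ F)
∏ᴹ-pull B F G zero below at elsewhere = begin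
  G zero *ᴹ ∏ᴹ (G ∘ suc)          ≈⟨ *ᴹ-cong at (∏ᴹ-cong (λ j′ → elsewhere (suc j′) λ ())) ⟩
  (B *ᴹ F zero) *ᴹ ∏ᴹ (F ∘ suc)   ≈⟨ *ᴹ-assoc B (F zero) _ ⟩
  B *ᴹ (F zero *ᴹ ∏ᴹ (F ∘ suc))   ∎
  where open SetoidReasoning (≈ᴹ-setoid _)
∏ᴹ-pull B F G (suc j) below at elsewhere = begin
  G zero *ᴹ ∏ᴹ (G ∘ suc)          ≈⟨ *ᴹ-congʳ (∏ᴹ (G ∘ suc)) (proj₂ first-is-I) ⟩
  Iᴹ *ᴹ ∏ᴹ (G ∘ suc)              ≈⟨ *ᴹ-identityˡ _ ⟩
  ∏ᴹ (G ∘ suc)                    ≈⟨ ∏ᴹ-pull B (F ∘ suc) (G ∘ suc) j below′ at elsewhere′ ⟩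
  B *ᴹ ∏ᴹ (F ∘ suc)               ≈⟨ *ᴹ-congˡ B (≈ᴹ-sym (*ᴹ-identityˡ _)) ⟩
  B *ᴹ (Iᴹ *ᴹ ∏ᴹ (F ∘ suc))       ≈⟨ *ᴹ-congˡ B (*ᴹ-congʳ (∏ᴹ (F ∘ suc)) (≈ᴹ-sym (proj₁ first-is-I))) ⟩
  B *ᴹ (F zero *ᴹ ∏ᴹ (F ∘ suc))   ∎
  where
  open SetoidReasoning (≈ᴹ-setoid _)
  first-is-I : F zero ≈ᴹ Iᴹ × G zero ≈ᴹ Iᴹ
  first-is-I = below zero (s≤s z≤n)
  below′ : ∀ j′ → j′ Fin.< j → F (suc j′) ≈ᴹ Iᴹ × G (suc j′) ≈ᴹ Iᴹ
  below′ j′ j′<j = below (suc j′) (s≤s j′<j)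
  elsewhere′ : ∀ j′ → j′ ≢ j → G (suc j′) ≈ᴹ F (suc j′)
  elsewhere′ j′ j′≢j = elsewhere (suc j′) (j′≢j ∘ suc-injective)

0⃗ : ∀ {ℓ} → Exp ℓ
0⃗ = Vec.tabulate (λ _ → 0)

VanishesBelow : ∀ {ℓ} → Fin ℓ → Exp ℓ → Set
VanishesBelow i a = ∀ j → j Fin.< i → lookup a j ≡ 0

⊕-identityʳ : ∀ {ℓ} (α : Exp ℓ) → α ⊕ 0⃗ ≡ α
⊕-identityʳ []      = refl
⊕-identityʳ (x ∷ α) = cong₂ _∷_ (ℕ.+-identityʳ x) (⊕-identityʳ α)

⊕-assoc : ∀ {ℓ} (α β γ : Exp ℓ) → (α ⊕ β) ⊕ γ ≡ α ⊕ (β ⊕ γ)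
⊕-assoc = Vec.zipWith-assoc ℕ.+-assoc

ε-suc : ∀ {ℓ} (i : Fin ℓ) → ε (suc i) ≡ 0 ∷ ε i
ε-suc i = cong (0 ∷_) (Vec.tabulate-cong λ j → cong (λ b → if b then 1 else 0) (⌊⌋-map′ _ _ (i ≟ᶠ j)))

∷-⊕-ε-zero : ∀ {ℓ} x (v : Exp ℓ) → (x ∷ v) ⊕ ε zero ≡ suc x ∷ v
∷-⊕-ε-zero x v = cong₂ _∷_ (ℕ.+-comm x 1) (⊕-identityʳ v)

lookup-⊕-ε : ∀ {ℓ} (a : Exp ℓ) i j → lookup (a ⊕ ε i) j ≡ lookup a j + (if ⌊ i ≟ᶠ j ⌋ then 1 else 0)
lookup-⊕-ε a i j = trans (Vec.lookup-zipWith _+_ j a (ε i)) (cong (lookup a j +_) (Vec.lookup∘tabulate _ j))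

lookup-⊕-ε-same : ∀ {ℓ} (a : Exp ℓ) i → lookup (a ⊕ ε i) i ≡ suc (lookup a i)
lookup-⊕-ε-same a i rewrite lookup-⊕-ε a i i | isYes≗does (i ≟ᶠ i) | dec-true (i ≟ᶠ i) refl = ℕ.+-comm _ 1

lookup-⊕-ε-other : ∀ {ℓ} (a : Exp ℓ) {i j} → i ≢ j → lookup (a ⊕ ε i) j ≡ lookup a j
lookup-⊕-ε-other a {i} {j} i≢j
  rewrite lookup-⊕-ε a i j | isYes≗does (i ≟ᶠ j) | dec-false (i ≟ᶠ j) i≢j = ℕ.+-identityʳ _

module _ {ℓ n : ℕ} (A : Exp ℓ → Mat n) where

  Apow≡∏ᴹ : (m : Exp ℓ) → Apow A m ≡ ∏ᴹ (λ k → A (ε k) ^ᴹ lookup m k)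
  Apow≡∏ᴹ m = foldr-tabulate (λ k → k)
    where
    foldr-tabulate : ∀ {k} (h : Fin k → Fin ℓ) →
      foldr (λ j M → (A (ε j) ^ᴹ lookup m j) *ᴹ M) Iᴹ (tabulate h)
        ≡ ∏ᴹ (λ j → A (ε (h j)) ^ᴹ lookup m (h j))
    foldr-tabulate {zero}  h = refl
    foldr-tabulate {suc k} h = cong ((A (ε (h zero)) ^ᴹ lookup m (h zero)) *ᴹ_) (foldr-tabulate (h ∘ suc))

  Apow-⊕-ε : ∀ (a : Exp ℓ) i → VanishesBelow i a → Apow A (a ⊕ ε i) ≈ᴹ (A (ε i) *ᴹ Apow A a)
  Apow-⊕-ε a i vanishes = begin
    Apow A (a ⊕ ε i)       ≡⟨ Apow≡∏ᴹ (a ⊕ ε i) ⟩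
    ∏ᴹ (power (a ⊕ ε i))   ≈⟨ ∏ᴹ-pull (A (ε i)) (power a) (power (a ⊕ ε i)) i below at elsewhere ⟩
    A (ε i) *ᴹ ∏ᴹ (power a) ≡⟨ cong (A (ε i) *ᴹ_) (Apow≡∏ᴹ a) ⟨
    A (ε i) *ᴹ Apow A a    ∎
    where
    open SetoidReasoning (≈ᴹ-setoid n)
    power : Exp ℓ → Fin ℓ → Mat n
    power m k = A (ε k) ^ᴹ lookup m k
    power-cong : ∀ k {e e′} → e ≡ e′ → (A (ε k) ^ᴹ e) ≈ᴹ (A (ε k) ^ᴹ e′)
    power-cong k eq = ≡⇒≈ᴹ (cong (A (ε k) ^ᴹ_) eq)
    below : ∀ j → j Fin.< i → power a j ≈ᴹ Iᴹ × power (a ⊕ ε i) j ≈ᴹ Iᴹ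
    below j j<i = power-cong j (vanishes j j<i)
                , power-cong j (trans (lookup-⊕-ε-other a (λ i≡j → <⇒≢ j<i (sym i≡j))) (vanishes j j<i))
    at : power (a ⊕ ε i) i ≈ᴹ (A (ε i) *ᴹ power a i)
    at = power-cong i (lookup-⊕-ε-same a i)
    elsewhere : ∀ j → j ≢ i → power (a ⊕ ε i) j ≈ᴹ power a j
    elsewhere j j≢i = power-cong j (lookup-⊕-ε-other a (j≢i ∘ sym))

record Boundary {ℓ} (P : Exp ℓ → Set) (α : Exp ℓ) : Set where
  constructor boundary
  field
    base     : Exp ℓ
    dir      : Fin ℓ
    excess   : Exp ℓ
    base∈P   : P base
    step∉P   : ¬ P (base ⊕ ε dir)
    vanishes : VanishesBelow dir base
    above    : α ≡ (base ⊕ ε dir) ⊕ excess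

Boundary-⊕ : ∀ {ℓ} {P : Exp ℓ → Set} {α} → Boundary P α → ∀ δ → Boundary P (α ⊕ δ)
Boundary-⊕ (boundary a i γ Pa ¬Pa′ v α≡) δ =
  boundary a i (γ ⊕ δ) Pa ¬Pa′ v (trans (cong (_⊕ δ) α≡) (⊕-assoc (a ⊕ ε i) γ δ))

Boundary-0∷ : ∀ {ℓ} {P : Exp (suc ℓ) → Set} {α} → Boundary (P ∘ (0 ∷_)) α → Boundary P (0 ∷ α)
Boundary-0∷ {P = P} (boundary a i γ Pa ¬Pa′ v α≡) =
  boundary (0 ∷ a) (suc i) (0 ∷ γ) Pa (¬Pa′ ∘ subst P shift) vanishes′
           (trans (cong (0 ∷_) α≡) (cong (_⊕ (0 ∷ γ)) (sym shift)))
  where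
  shift : (0 ∷ a) ⊕ ε (suc i) ≡ 0 ∷ (a ⊕ ε i)
  shift = cong ((0 ∷ a) ⊕_) (ε-suc i)
  vanishes′ : VanishesBelow (suc i) (0 ∷ a)
  vanishes′ zero    _           = refl
  vanishes′ (suc j) (s≤s j<i) = v j j<i

boundary-below : ∀ {ℓ} (P : Exp ℓ → Set) → Decidable P → P 0⃗ → ∀ α → ¬ P α → Boundary P α
boundary-below P P? P0 []      ¬Pα = ⊥-elim (¬Pα P0)
boundary-below P P? P0 (x ∷ v) ¬Pα = boundary-below-∷ P P? P0 x v ¬Pα
  where
  boundary-below-∷ : ∀ {ℓ} (P : Exp (suc ℓ) → Set) → Decidable P → P 0⃗ →
                     ∀ x v → ¬ P (x ∷ v) → Boundary P (x ∷ v)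
  boundary-below-∷ P P? P0 zero    []      ¬Pα = ⊥-elim (¬Pα P0)
  boundary-below-∷ P P? P0 zero    (y ∷ w) ¬Pα =
    Boundary-0∷ (boundary-below-∷ (P ∘ (0 ∷_)) (P? ∘ (0 ∷_)) P0 y w ¬Pα)
  boundary-below-∷ P P? P0 (suc x) v       ¬Pα with P? (x ∷ v)
  ... | yes Pxv = boundary (x ∷ v) zero 0⃗ Pxv (¬Pα ∘ subst P (∷-⊕-ε-zero x v)) (λ _ ())
                           (sym (trans (⊕-identityʳ _) (∷-⊕-ε-zero x v)))
  ... | no ¬Pxv = subst (Boundary P) (∷-⊕-ε-zero x v)
                        (Boundary-⊕ (boundary-below-∷ P P? P0 x v ¬Pxv) (ε zero))

module _ {ℓ : ℕ} where

  open import Data.List.Membership.DecPropositional (_≟ᵉ_ {ℓ}) public using (_∈?_)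

  ⌊≟ᵉ⌋-comm : (α β : Exp ℓ) → ⌊ α ≟ᵉ β ⌋ ≡ ⌊ β ≟ᵉ α ⌋
  ⌊≟ᵉ⌋-comm α β = trans (isYes≗does (α ≟ᵉ β))
                 (trans (does-≡ (α ≟ᵉ β) (map′ sym sym (β ≟ᵉ α)))
                        (sym (isYes≗does (β ≟ᵉ α))))

  restrict : List (Exp ℓ) → (Exp ℓ → ℚ) → Exp ℓ → ℚ
  restrict L c γ = if ⌊ γ ∈? L ⌋ then c γ else 0ℚ

  module _ (L : List (Exp ℓ)) (c : Exp ℓ → ℚ) {γ : Exp ℓ} where

    restrict-∈ : γ ∈ L → restrict L c γ ≡ c γ
    restrict-∈ γ∈L with γ ∈? L
    ... | yes _    = refl
    ... | no γ∉L  = ⊥-elim (γ∉L γ∈L)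

    restrict-∉ : ¬ γ ∈ L → restrict L c γ ≡ 0ℚ
    restrict-∉ γ∉L with γ ∈? L
    ... | yes γ∈L = ⊥-elim (γ∉L γ∈L)
    ... | no _    = refl

    restrict-support : restrict L c γ ≢ 0ℚ → γ ∈ L × c γ ≢ 0ℚ
    restrict-support ≢0 with γ ∈? L
    ... | yes γ∈L = γ∈L , ≢0
    ... | no _    = ⊥-elim (≢0 refl)

  fromCoeffs : List (Exp ℓ) → (Exp ℓ → ℚ) → Poly ℓ
  fromCoeffs L h = map (λ β → (h β , β)) L

  coeff-fromCoeffs-∉ : ∀ L (h : Exp ℓ → ℚ) {γ} → ¬ γ ∈ L → coeff (fromCoeffs L h) γ ≡ 0ℚ
  coeff-fromCoeffs-∉ []      h γ∉L = refl
  coeff-fromCoeffs-∉ (β ∷ L) h {γ} γ∉L with β ≟ᵉ γ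
  ... | yes β≡γ = ⊥-elim (γ∉L (here (sym β≡γ)))
  ... | no _    = trans (ℚ.+-identityˡ _) (coeff-fromCoeffs-∉ L h (γ∉L ∘ there))

  coeff-fromCoeffs-∈ : ∀ {L} (h : Exp ℓ → ℚ) → Unique L →
                       ∀ {γ} → γ ∈ L → coeff (fromCoeffs L h) γ ≡ h γ
  coeff-fromCoeffs-∈ {β ∷ L} h (β∉L ∷ unique) {γ} γ∈ with β ≟ᵉ γ | γ∈
  ... | yes refl | _         =
    trans (cong (h β ℚ.+_) (coeff-fromCoeffs-∉ L h (λ β∈L → All.lookup β∉L β∈L refl))) (ℚ.+-identityʳ (h β))
  ... | no β≢γ   | here γ≡β  = ⊥-elim (β≢γ (sym γ≡β))
  ... | no _     | there γ∈L = trans (ℚ.+-identityˡ _) (coeff-fromCoeffs-∈ h unique γ∈L)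

  coeff-fromCoeffs : ∀ {L} (h : Exp ℓ → ℚ) → Unique L → (∀ γ → ¬ γ ∈ L → h γ ≡ 0ℚ) →
                     ∀ γ → coeff (fromCoeffs L h) γ ≡ h γ
  coeff-fromCoeffs {L} h unique outside γ with γ ∈? L
  ... | yes γ∈L = coeff-fromCoeffs-∈ h unique γ∈L
  ... | no γ∉L  = trans (coeff-fromCoeffs-∉ L h γ∉L) (sym (outside γ γ∉L))

module _ {ℓ n} (ord : MonomialOrder ℓ) (Ds : List (Exp ℓ)) (A : Exp ℓ → Mat n)
         (pp : IsPPolynomial ord Ds A) where

  open MonomialOrder ord
  open IsTotalOrder isTotalOrder using () renaming (refl to ≤ₘ-refl)
  open IsPPolynomial pp
  open IsCommAssocScheme scheme using (labelsDistinct; hasIdentity)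

  0⃗∈Ds : 0⃗ ∈ Ds
  0⃗∈Ds with hasIdentity
  ... | α , α∈Ds , _ =
    downClosed α 0⃗ α∈Ds λ k → subst (_≤ lookup α k) (sym (Vec.lookup∘tabulate _ k)) z≤n

  boundary∈MD𝒢 : ∀ {a i} → a ∈ Ds → ¬ (a ⊕ ε i) ∈ Ds → VanishesBelow i a → InMDG ord Ds A (a ⊕ ε i)
  boundary∈MD𝒢 {a} {i} a∈Ds δ∉Ds vanishes = w , w∈𝒢 , MD-w
    where
    δ : Exp ℓ
    δ = a ⊕ ε i
    c : Exp ℓ → ℚ
    c = proj₁ (recurrence i a a∈Ds)
    c-bound : ∀ β → c β ≢ 0ℚ → β ≤ₘ δ
    c-bound = proj₁ (proj₂ (recurrence i a a∈Ds))
    c-recurrence : (A (ε i) *ᴹ Apow A a) ≈ᴹ Σᴹ Ds (λ β → c β ·ᴹ Apow A β)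
    c-recurrence = proj₂ (proj₂ (recurrence i a a∈Ds))
    c′ : Exp ℓ → ℚ
    c′ = restrict Ds c

    w : Poly ℓ
    w = (1ℚ , δ) ∷ fromCoeffs Ds (λ β → ℚ.- c′ β)

    coeff-w : ∀ γ → coeff w γ ≡ (if ⌊ γ ≟ᵉ δ ⌋ then 1ℚ else 0ℚ) ℚ.- c′ γ
    coeff-w γ =
      cong₂ ℚ._+_ (cong (λ b → if b then 1ℚ else 0ℚ) (⌊≟ᵉ⌋-comm δ γ))
                  (coeff-fromCoeffs _ labelsDistinct (λ β β∉Ds → cong ℚ.-_ (restrict-∉ Ds c β∉Ds)) γ)

    c′-support : ∀ β → c′ β ≢ 0ℚ → β ∈ Ds × β <ₘ δ
    c′-support β c′β≢0 = let β∈Ds , cβ≢0 = restrict-support Ds c c′β≢0 in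
      β∈Ds , c-bound β cβ≢0 , λ β≡δ → δ∉Ds (subst (_∈ Ds) β≡δ β∈Ds)

    Apow-δ : Apow A δ ≈ᴹ Σᴹ Ds (λ β → c′ β ·ᴹ Apow A β)
    Apow-δ = ≈ᴹ-trans (Apow-⊕-ε A a i vanishes) (≈ᴹ-trans c-recurrence
               (Σᴹ-cong Ds λ β β∈Ds x y → cong (ℚ._* Apow A β x y) (sym (restrict-∈ Ds c β∈Ds))))

    w∈𝒢 : InG ord Ds A w
    w∈𝒢 = a , i , a∈Ds , δ∉Ds , c′ , c′-support , Apow-δ , coeff-w

    leading : coeff w δ ≡ 1ℚ
    leading = trans (coeff-w δ) (cong₂ (λ b q → (if b then 1ℚ else 0ℚ) ℚ.- q)
                                       (trans (isYes≗does (δ ≟ᵉ δ)) (dec-true (δ ≟ᵉ δ) refl))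
                                       (restrict-∉ Ds c δ∉Ds))

    below-δ : ∀ γ → coeff w γ ≢ 0ℚ → γ ≤ₘ δ
    below-δ γ wγ≢0 with γ ≟ᵉ δ | coeff-w γ
    ... | yes refl | _    = ≤ₘ-refl
    ... | no _     | wγ≡ =
      c-bound γ (proj₂ (restrict-support Ds c λ c′γ≡0 → wγ≢0 (trans wγ≡ (cong (λ q → 0ℚ ℚ.- q) c′γ≡0))))

    MD-w : IsMD ord w δ
    MD-w = (λ wδ≡0 → contradiction (trans (sym leading) wδ≡0) λ ()) , below-δ

mainTheorem9 : ∀ {ℓ n} (ord : MonomialOrder ℓ) (Ds : List (Exp ℓ)) (A : Exp ℓ → Mat n) →
    IsPPolynomial ord Ds A →
    ∀ (α : Exp ℓ) → ¬ (α ∈ Ds) →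
    ∃ λ (β₀ : Exp ℓ) → ∃ λ (γ₀ : Exp ℓ) → InMDG ord Ds A β₀ × (α ≡ β₀ ⊕ γ₀)
mainTheorem9 ord Ds A pp α α∉Ds
  with boundary a i γ a∈Ds δ∉Ds vanishes α≡
         ← boundary-below (_∈ Ds) (_∈? Ds) (0⃗∈Ds ord Ds A pp) α α∉Ds
  = a ⊕ ε i , γ , boundary∈MD𝒢 ord Ds A pp a∈Ds δ∉Ds vanishes , α≡
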